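{- Let $G$ be a finite $3$-group with a normal subgroup $H\cong C_3\times C_3$. If $G/H$ is colourable, then $G$ is colourable.
   Context: A bijection $\sigma$ of a group $Q$ is a colouring bijection if the maps $x\mapsto\sigma(x)x$, $x\mapsto x^{ -1}\sigma(x)$, $x\mapsto x^{ -1}\sigma(x)x$ are all bijections of $Q$; $Q$ is colourable if it admits a colouring bijection. -}

module Defs where

open import Level using (Level; _⊔_; 0ℓ)
open import Data.Nat using (ℕ; _^_)
open import Data.Fin using (Fin; zero; suc)
open import Data.Product using (Σ; ∃; _×_; _,_)
open import Relation.Binary.PropositionalEquality using (_≡_; setoid)
open import Algebra.Bundles using (Group)
open import Algebra.Bundles.Raw using (RawGroup)
open import Algebra.Construct.DirectProduct renaming (rawGroup to rawGroup×) using ()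
open import Algebra.Morphism.Structures using (module GroupMorphisms)
open import Function.Definitions using (Congruent; Bijective)
open import Function.Bundles using (Bijection)

-- Colouring bijections, for a group given by its raw operations on a
-- carrier with an equality relation (so it applies both to a group G
-- and to a quotient G/H, whose equality is "same coset").

IsBijectionOf : ∀ {c ℓ} (Q : RawGroup c ℓ) → (RawGroup.Carrier Q → RawGroup.Carrier Q) → Set (c ⊔ ℓ)
IsBijectionOf Q f = Congruent _≈_ _≈_ f × Bijective _≈_ _≈_ f
  where open RawGroup Q

IsColouringBijection : ∀ {c ℓ} (Q : RawGroup c ℓ) → (RawGroup.Carrier Q → RawGroup.Carrier Q) → Set (c ⊔ ℓ)
IsColouringBijection Q σ =
  IsBijectionOf Q σ
  × IsBijectionOf Q (λ x → σ x ∙ x)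
  × IsBijectionOf Q (λ x → x ⁻¹ ∙ σ x)
  × IsBijectionOf Q (λ x → x ⁻¹ ∙ σ x ∙ x)
  where open RawGroup Q

Colourable : ∀ {c ℓ} (Q : RawGroup c ℓ) → Set (c ⊔ ℓ)
Colourable Q = Σ (RawGroup.Carrier Q → RawGroup.Carrier Q) (IsColouringBijection Q)

ColourableGroup : ∀ {c ℓ} (G : Group c ℓ) → Set (c ⊔ ℓ)
ColourableGroup G = Colourable (Group.rawGroup G)

IsFinite3Group : ∀ {c ℓ} (G : Group c ℓ) → Set (c ⊔ ℓ)
IsFinite3Group G = ∃ λ (k : ℕ) → Bijection (Group.setoid G) (setoid (Fin (3 ^ k)))

_+₃_ : Fin 3 → Fin 3 → Fin 3
zero +₃ y = y
suc zero +₃ zero = suc zero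
suc zero +₃ suc zero = suc (suc zero)
suc zero +₃ suc (suc zero) = zero
suc (suc zero) +₃ zero = suc (suc zero)
suc (suc zero) +₃ suc zero = zero
suc (suc zero) +₃ suc (suc zero) = suc zero

-₃_ : Fin 3 → Fin 3
-₃ zero = zero
-₃ suc zero = suc (suc zero)
-₃ suc (suc zero) = suc zero

C₃ : RawGroup 0ℓ 0ℓ
C₃ = record
  { Carrier = Fin 3
  ; _≈_ = _≡_
  ; _∙_ = _+₃_
  ; ε = zero
  ; _⁻¹ = -₃_
  }

C₃×C₃ : RawGroup 0ℓ 0ℓ
C₃×C₃ = rawGroup× C₃ C₃

record NormalC₃×C₃ {c ℓ} (G : Group c ℓ) : Set (c ⊔ ℓ) where
  open Group G
  field
    φ      : RawGroup.Carrier C₃×C₃ → Carrier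
    isMono : GroupMorphisms.IsGroupMonomorphism C₃×C₃ rawGroup φ
    normal : ∀ (g : Carrier) (a : RawGroup.Carrier C₃×C₃) →
             ∃ λ (b : RawGroup.Carrier C₃×C₃) → (g ∙ φ a) ∙ g ⁻¹ ≈ φ b

  _∈H : Carrier → Set ℓ
  x ∈H = ∃ λ (a : RawGroup.Carrier C₃×C₃) → x ≈ φ a

Quotient : ∀ {c ℓ} (G : Group c ℓ) → NormalC₃×C₃ G → RawGroup c ℓ
Quotient G H = record
  { Carrier = Carrier
  ; _≈_ = λ x y → ∃ λ (a : RawGroup.Carrier C₃×C₃) → x ≈ y ∙ φ a
  ; _∙_ = _∙_
  ; ε = ε
  ; _⁻¹ = _⁻¹
  }
  where open Group G
        open NormalC₃×C₃ H

{-# OPTIONS --safe #-}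
module Submission where

-- Choose a transversal T of H = φ(F₃²) in G, so that every x ∈ G is uniquely
-- x = t φ(h) with t ∈ T and h ∈ F₃².  Given a colouring bijection τ of G/H,
-- put σ(t φ(h)) = τ(t) φ(M h) for a matrix M = M_t.  Pushing the factors φ(·)
-- to the right by conjugation, each of the maps σ(x), σ(x) x, x⁻¹ σ(x),
-- x⁻¹ σ(x) x sends t φ(h) to (the corresponding map of τ applied to t) times
-- φ(N h), where N is respectively
--
--   M,   A M + 1,   M - B,   A (M - B) + 1,
--
-- with A, B the matrices of conjugation by t and by t⁻¹ τ(t).  Such a map is a
-- bijection of G as soon as τ's map is one on cosets and N is invertible, and
-- an exhaustive search over M₂(F₃) shows that for every pair A, B some M makes
-- all four matrices invertible.

open import Level using (Level)
open import Data.Bool using (true)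
open import Data.Fin using (Fin; zero; suc)
open import Data.Fin.Patterns using (0F; 1F; 2F)
open import Data.Fin.Properties using () renaming (_≟_ to _≟F_)
open import Data.Nat using (suc)
open import Data.Product using (∃; _×_; _,_; proj₁; proj₂; curry; uncurry; map)
open import Data.Product.Properties using (≡-dec; ×-≡,≡→≡)
open import Data.Sum using (inj₁; inj₂)
open import Function using (_∘_; id)
open import Function.Bundles using (Bijection)
open import Function.Definitions using (Congruent; StrictlyInverseˡ; StrictlyInverseʳ)
open import Relation.Binary using (Rel; IsEquivalence; DecidableEquality) renaming (Decidable to Decidable₂)
open import Relation.Binary.PropositionalEquality as ≡
  using (_≡_; _≢_; refl; cong; cong₂; _≗_; module ≡-Reasoning)
open import Relation.Nullary using (Dec; yes; no; does; contradiction)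
open import Relation.Nullary.Decidable using (map′; ¬?; _×-dec_; _⊎-dec_; _→-dec_)
open import Relation.Unary using (Pred; Decidable)
open import Algebra.Bundles using (Group)
open import Algebra.Bundles.Raw using (RawGroup)
open import Algebra.Morphism.Structures using (module GroupMorphisms)
open import Defs

private
  variable
    a p q : Level
    A : Set a

-- Unlike toWitness, this does not make the type checker re-evaluate the
-- decision procedure while elaborating the witness.
decided : (a? : Dec A) → does a? ≡ true → A
decided (yes a) _ = a

firstWitness : ∀ {n} {P : Pred (Fin n) p} → Decidable P → ∃ P → ∃ P
firstWitness {n = suc n} P? w with P? zero | w
... | yes P₀ | _          = zero , P₀
... | no ¬P₀ | zero , P₀  = contradiction P₀ ¬P₀
... | no _   | suc i , Pᵢ = map suc id (firstWitness (P? ∘ suc) (i , Pᵢ))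

firstWitness-cong : ∀ {n} {P : Pred (Fin n) p} {Q : Pred (Fin n) q} (P? : Decidable P) (Q? : Decidable Q) →
                    (∀ i → P i → Q i) → (∀ i → Q i → P i) → (v : ∃ P) (w : ∃ Q) →
                    proj₁ (firstWitness P? v) ≡ proj₁ (firstWitness Q? w)
firstWitness-cong {n = suc n} P? Q? P⇒Q Q⇒P v w with P? zero | v | Q? zero | w
... | yes _  | _          | yes _  | _          = refl
... | yes P₀ | _          | no ¬Q₀ | _          = contradiction (P⇒Q zero P₀) ¬Q₀
... | no ¬P₀ | _          | yes Q₀ | _          = contradiction (Q⇒P zero Q₀) ¬P₀
... | no ¬P₀ | zero , P₀  | no _   | _          = contradiction P₀ ¬P₀
... | no _   | suc _ , _  | no ¬Q₀ | zero , Q₀  = contradiction Q₀ ¬Q₀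
... | no _   | suc i , Pᵢ | no _   | suc j , Qⱼ =
  cong suc (firstWitness-cong (P? ∘ suc) (Q? ∘ suc) (P⇒Q ∘ suc) (Q⇒P ∘ suc) (i , Pᵢ) (j , Qⱼ))

module CanonicalRepresentative
  {ℓ n} {_~_ : Rel A ℓ} (~-isEquivalence : IsEquivalence _~_) (_~?_ : Decidable₂ _~_)
  (enum : Fin n → A) (enum-complete : ∀ x → ∃ λ i → enum i ~ x) where

  open IsEquivalence ~-isEquivalence

  private
    index : ∀ x → ∃ λ i → enum i ~ x
    index x = firstWitness (λ i → enum i ~? x) (enum-complete x)

  canonical : A → A
  canonical x = enum (proj₁ (index x))

  canonical-~ : ∀ x → canonical x ~ x
  canonical-~ x = proj₂ (index x)

  canonical-cong : ∀ {x y} → x ~ y → canonical x ≡ canonical y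
  canonical-cong x~y = cong enum (firstWitness-cong _ _
    (λ _ i~x → trans i~x x~y) (λ _ i~y → trans i~y (sym x~y)) _ _)

-- The plane F₃² and its 2 × 2 matrices

F₃ : Set
F₃ = RawGroup.Carrier C₃

V : Set
V = RawGroup.Carrier C₃×C₃

Mat : Set
Mat = V × V

∀-F₃? : {P : Pred F₃ p} → Decidable P → Dec (∀ x → P x)
∀-F₃? P? = map′ (λ (p₀ , p₁ , p₂) → λ { 0F → p₀ ; 1F → p₁ ; 2F → p₂ })
                (λ p → p 0F , p 1F , p 2F)
                (P? 0F ×-dec P? 1F ×-dec P? 2F)

∃-F₃? : {P : Pred F₃ p} → Decidable P → Dec (∃ P)
∃-F₃? P? = map′ (λ { (inj₁ p) → 0F , p ; (inj₂ (inj₁ p)) → 1F , p ; (inj₂ (inj₂ p)) → 2F , p })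
                (λ { (0F , p) → inj₁ p ; (1F , p) → inj₂ (inj₁ p) ; (2F , p) → inj₂ (inj₂ p) })
                (P? 0F ⊎-dec P? 1F ⊎-dec P? 2F)

∀-V? : {P : Pred V p} → Decidable P → Dec (∀ v → P v)
∀-V? P? = map′ uncurry curry (∀-F₃? λ x → ∀-F₃? λ y → P? (x , y))

∃-V? : {P : Pred V p} → Decidable P → Dec (∃ P)
∃-V? P? = map′ (λ (x , y , p) → (x , y) , p) (λ ((x , y) , p) → x , y , p)
               (∃-F₃? λ x → ∃-F₃? λ y → P? (x , y))

∀-Mat? : {P : Pred Mat p} → Decidable P → Dec (∀ N → P N)
∀-Mat? P? = map′ uncurry curry (∀-V? λ u → ∀-V? λ v → P? (u , v))

∃-Mat? : {P : Pred Mat p} → Decidable P → Dec (∃ P)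
∃-Mat? P? = map′ (λ (u , v , p) → (u , v) , p) (λ ((u , v) , p) → u , v , p)
                 (∃-V? λ u → ∃-V? λ v → P? (u , v))

infixl 6 _⊕_
infixr 7 _·_
infix 4 _≟_

_⊕_ : V → V → V
_⊕_ = RawGroup._∙_ C₃×C₃

⊖_ : V → V
⊖_ = RawGroup._⁻¹ C₃×C₃

𝟘 : V
𝟘 = RawGroup.ε C₃×C₃

_≟_ : DecidableEquality V
_≟_ = ≡-dec _≟F_ _≟F_

_·₃_ : F₃ → F₃ → F₃
0F ·₃ _ = 0F
1F ·₃ y = y
2F ·₃ y = y +₃ y

_·_ : F₃ → V → V
k · (x , y) = k ·₃ x , k ·₃ y

e₁ e₂ : V
e₁ = 1F , 0F
e₂ = 0F , 1F

-- A matrix is given by its two columns.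
⟦_⟧ : Mat → V → V
⟦ c₁ , c₂ ⟧ (x , y) = x · c₁ ⊕ y · c₂

matrixOf : (V → V) → Mat
matrixOf f = f e₁ , f e₂

det : Mat → F₃
det ((a , c) , (b , d)) = (a ·₃ d) +₃ (-₃ (b ·₃ c))

-- The adjugate divided by the determinant; in F₃ every unit is its own inverse.
inverse : Mat → Mat
inverse N@((a , c) , (b , d)) = det N · (d , -₃ c) , det N · (-₃ b , a)

⊕-interchange : ∀ u v w z → (u ⊕ v) ⊕ (w ⊕ z) ≡ (u ⊕ w) ⊕ (v ⊕ z)
⊕-interchange = decided (∀-V? λ u → ∀-V? λ v → ∀-V? λ w → ∀-V? λ z →
  (u ⊕ v) ⊕ (w ⊕ z) ≟ (u ⊕ w) ⊕ (v ⊕ z)) refl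

⊕-idem⇒𝟘 : ∀ v → v ⊕ v ≡ v → v ≡ 𝟘
⊕-idem⇒𝟘 = decided (∀-V? λ v → (v ⊕ v ≟ v) →-dec (v ≟ 𝟘)) refl

⟦e₁,e₂⟧≗id : ⟦ e₁ , e₂ ⟧ ≗ id
⟦e₁,e₂⟧≗id = decided (∀-V? λ v → ⟦ e₁ , e₂ ⟧ v ≟ v) refl

inverse-correct : ∀ N → det N ≢ 0F →
  StrictlyInverseˡ _≡_ ⟦ N ⟧ ⟦ inverse N ⟧ × StrictlyInverseʳ _≡_ ⟦ N ⟧ ⟦ inverse N ⟧
inverse-correct = decided (∀-Mat? λ N → ¬? (det N ≟F 0F) →-dec
  (∀-V? λ v → ⟦ N ⟧ (⟦ inverse N ⟧ v) ≟ v) ×-dec (∀-V? λ v → ⟦ inverse N ⟧ (⟦ N ⟧ v) ≟ v)) refl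

record IsAdditive (f : V → V) : Set where
  constructor additive
  field ⊕-homo : ∀ u v → f (u ⊕ v) ≡ f u ⊕ f v

open IsAdditive

⊖-additive : IsAdditive ⊖_
⊖-additive = additive (decided (∀-V? λ u → ∀-V? λ v → ⊖ (u ⊕ v) ≟ ⊖ u ⊕ ⊖ v) refl)

⟦⟧-additive : ∀ N → IsAdditive ⟦ N ⟧
⟦⟧-additive N = additive (⊕-homo-⟦⟧ N)
  where
  ⊕-homo-⟦⟧ : ∀ N u v → ⟦ N ⟧ (u ⊕ v) ≡ ⟦ N ⟧ u ⊕ ⟦ N ⟧ v
  ⊕-homo-⟦⟧ = decided (∀-Mat? λ N → ∀-V? λ u → ∀-V? λ v → ⟦ N ⟧ (u ⊕ v) ≟ ⟦ N ⟧ u ⊕ ⟦ N ⟧ v) refl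

id-additive : IsAdditive id
id-additive = additive λ _ _ → refl

∘-additive : {f g : V → V} → IsAdditive f → IsAdditive g → IsAdditive (f ∘ g)
∘-additive {f} {g} f-add g-add = additive λ u v →
  ≡.trans (cong f (⊕-homo g-add u v)) (⊕-homo f-add (g u) (g v))

⊕-additive : {f g : V → V} → IsAdditive f → IsAdditive g → IsAdditive (λ v → f v ⊕ g v)
⊕-additive {f} {g} f-add g-add = additive λ u v →
  ≡.trans (cong₂ _⊕_ (⊕-homo f-add u v) (⊕-homo g-add u v)) (⊕-interchange (f u) (f v) (g u) (g v))

module _ {f : V → V} (f-add : IsAdditive f) where

  additive-𝟘 : f 𝟘 ≡ 𝟘
  additive-𝟘 = ⊕-idem⇒𝟘 (f 𝟘) (≡.sym (⊕-homo f-add 𝟘 𝟘))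

  additive-· : ∀ k v → f (k · v) ≡ k · f v
  additive-· 0F v = additive-𝟘
  additive-· 1F v = refl
  additive-· 2F v = ⊕-homo f-add v v

  additive⇒linear : f ≗ ⟦ matrixOf f ⟧
  additive⇒linear v@(x , y) = begin
    f v                         ≡⟨ cong f (≡.sym (⟦e₁,e₂⟧≗id v)) ⟩
    f (x · e₁ ⊕ y · e₂)         ≡⟨ ⊕-homo f-add (x · e₁) (y · e₂) ⟩
    f (x · e₁) ⊕ f (y · e₂)     ≡⟨ cong₂ _⊕_ (additive-· x e₁) (additive-· y e₂) ⟩
    x · f e₁ ⊕ y · f e₂         ∎
    where open ≡-Reasoning

Invertible : (V → V) → Set
Invertible f = ∃ λ g → StrictlyInverseˡ _≡_ f g × StrictlyInverseʳ _≡_ f g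

invertible⇒injective : {f : V → V} → Invertible f → ∀ {u v} → f u ≡ f v → u ≡ v
invertible⇒injective {f} (g , _ , g∘f) {u} {v} fu≡fv =
  ≡.trans (≡.sym (g∘f u)) (≡.trans (cong g fu≡fv) (g∘f v))

NonSingular : (V → V) → Set
NonSingular f = det (matrixOf f) ≢ 0F

nonSingular? : ∀ f → Dec (NonSingular f)
nonSingular? f = ¬? (det (matrixOf f) ≟F 0F)

additive-nonSingular⇒invertible : {f : V → V} → IsAdditive f → NonSingular f → Invertible f
additive-nonSingular⇒invertible {f} f-add f-nonSingular =
    ⟦ inverse N ⟧
  , (λ v → ≡.trans (f≗⟦N⟧ (⟦ inverse N ⟧ v)) (N∘N⁻¹ v))
  , (λ v → ≡.trans (cong ⟦ inverse N ⟧ (f≗⟦N⟧ v)) (N⁻¹∘N v))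
  where
  N = matrixOf f
  f≗⟦N⟧ = additive⇒linear f-add
  N∘N⁻¹ = proj₁ (inverse-correct N f-nonSingular)
  N⁻¹∘N = proj₂ (inverse-correct N f-nonSingular)

-- If x = t φ(h), σ(x) = s φ(M h), and A, B are the matrices of conjugation by
-- t and by t⁻¹ s, then σ(x), σ(x) x, x⁻¹ σ(x), x⁻¹ σ(x) x have H-coordinates
-- fibre₁ h, …, fibre₄ h.
module Fibres (A B M : Mat) where

  fibre₁ fibre₂ fibre₃ fibre₄ : V → V
  fibre₁ = ⟦ M ⟧
  fibre₂ h = ⟦ A ⟧ (fibre₁ h) ⊕ h
  fibre₃ h = ⟦ B ⟧ (⊖ h) ⊕ fibre₁ h
  fibre₄ h = ⟦ A ⟧ (fibre₃ h) ⊕ h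

  Admissible : Set
  Admissible = NonSingular fibre₁ × NonSingular fibre₂ × NonSingular fibre₃ × NonSingular fibre₄

  admissible? : Dec Admissible
  admissible? = nonSingular? fibre₁ ×-dec nonSingular? fibre₂ ×-dec nonSingular? fibre₃ ×-dec nonSingular? fibre₄

  fibre₂-additive : IsAdditive fibre₂
  fibre₂-additive = ⊕-additive (∘-additive (⟦⟧-additive A) (⟦⟧-additive M)) id-additive

  fibre₃-additive : IsAdditive fibre₃
  fibre₃-additive = ⊕-additive (∘-additive (⟦⟧-additive B) ⊖-additive) (⟦⟧-additive M)

  fibre₄-additive : IsAdditive fibre₄
  fibre₄-additive = ⊕-additive (∘-additive (⟦⟧-additive A) fibre₃-additive) id-additive

  fibre₁-invertible : Admissible → Invertible fibre₁
  fibre₁-invertible (ns , _) = additive-nonSingular⇒invertible (⟦⟧-additive M) ns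

  fibre₂-invertible : Admissible → Invertible fibre₂
  fibre₂-invertible (_ , ns , _) = additive-nonSingular⇒invertible fibre₂-additive ns

  fibre₃-invertible : Admissible → Invertible fibre₃
  fibre₃-invertible (_ , _ , ns , _) = additive-nonSingular⇒invertible fibre₃-additive ns

  fibre₄-invertible : Admissible → Invertible fibre₄
  fibre₄-invertible (_ , _ , _ , ns) = additive-nonSingular⇒invertible fibre₄-additive ns

-- Opaque, so that unification never unfolds the exhaustive search.
opaque
  admissible-exists : ∀ A B → ∃ λ M → Fibres.Admissible A B M
  admissible-exists = decided (∀-Mat? λ A → ∀-Mat? λ B → ∃-Mat? (Fibres.admissible? A B)) refl

-- Cosets of H and the lift of τ

module _ {c ℓ} (G : Group c ℓ) where
  open Group G

  isBijection-resp : ∀ {f g} → (∀ x → g x ≈ f x) → Congruent _≈_ _≈_ g →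
                     IsBijectionOf rawGroup f → IsBijectionOf rawGroup g
  isBijection-resp g≈f g-cong (_ , f-injective , f-surjective) =
      g-cong
    , (λ gx≈gy → f-injective (trans (sym (g≈f _)) (trans gx≈gy (g≈f _))))
    , (λ y → map id (λ fz≈y z≈x → trans (g≈f _) (fz≈y z≈x)) (f-surjective y))

module Cosets {c ℓ} (G : Group c ℓ) (H : NormalC₃×C₃ G) where

  open Group G renaming (refl to ≈-refl)
  open NormalC₃×C₃ H
  open import Algebra.Properties.Group G using (∙-cancelˡ; \\-leftDividesˡ; //-rightDividesʳ; ⁻¹-anti-homo-∙; ⁻¹-involutive)
  open import Relation.Binary.Reasoning.Setoid setoid
  private module φ = GroupMorphisms.IsGroupMonomorphism isMono

  ∙φ-injective : ∀ t {a b} → t ∙ φ a ≈ t ∙ φ b → a ≡ b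
  ∙φ-injective t = ×-≡,≡→≡ ∘ φ.injective ∘ ∙-cancelˡ t _ _

  ∙φ∙φ : ∀ x a b → (x ∙ φ a) ∙ φ b ≈ x ∙ φ (a ⊕ b)
  ∙φ∙φ x a b = trans (assoc x (φ a) (φ b)) (∙-congˡ (sym (φ.∙-homo a b)))

  -- Definitionally the equality of Quotient G H.
  infix 4 _~_
  _~_ : Rel Carrier ℓ
  x ~ y = ∃ λ a → x ≈ y ∙ φ a

  ≈⇒~ : ∀ {x y} → x ≈ y → x ~ y
  ≈⇒~ {x} {y} x≈y = 𝟘 , (begin
    x        ≈⟨ x≈y ⟩
    y        ≈⟨ identityʳ y ⟨
    y ∙ ε    ≈⟨ ∙-congˡ φ.ε-homo ⟨
    y ∙ φ 𝟘  ∎)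

  ~-sym : ∀ {x y} → x ~ y → y ~ x
  ~-sym {x} {y} (a , x≈y∙φa) = ⊖ a , (begin
    y                  ≈⟨ //-rightDividesʳ (φ a) y ⟨
    y ∙ φ a ∙ φ a ⁻¹   ≈⟨ ∙-cong x≈y∙φa (φ.⁻¹-homo a) ⟨
    x ∙ φ (⊖ a)        ∎)

  ~-trans : ∀ {x y z} → x ~ y → y ~ z → x ~ z
  ~-trans {x} {y} {z} (a , x≈y∙φa) (b , y≈z∙φb) = b ⊕ a , (begin
    x              ≈⟨ x≈y∙φa ⟩
    y ∙ φ a        ≈⟨ ∙-congʳ y≈z∙φb ⟩
    z ∙ φ b ∙ φ a  ≈⟨ ∙φ∙φ z b a ⟩
    z ∙ φ (b ⊕ a)  ∎)

  ~-isEquivalence : IsEquivalence _~_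
  ~-isEquivalence = record { refl = ≈⇒~ ≈-refl ; sym = ~-sym ; trans = ~-trans }

  ∙φ≈∙φ⇒~ : ∀ {x y a b} → x ∙ φ a ≈ y ∙ φ b → x ~ y
  ∙φ≈∙φ⇒~ {x} {y} {a} {b} e = ~-trans (~-sym (a , ≈-refl)) (~-trans (≈⇒~ e) (b , ≈-refl))

  conj : Carrier → V → V
  conj g a = proj₁ (normal (g ⁻¹) a)

  φ∙≈∙φ-conj : ∀ g a → φ a ∙ g ≈ g ∙ φ (conj g a)
  φ∙≈∙φ-conj g a = begin
    φ a ∙ g                    ≈⟨ \\-leftDividesˡ g (φ a ∙ g) ⟨
    g ∙ (g ⁻¹ ∙ (φ a ∙ g))     ≈⟨ ∙-congˡ (assoc (g ⁻¹) (φ a) g) ⟨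
    g ∙ (g ⁻¹ ∙ φ a ∙ g)       ≈⟨ ∙-congˡ (∙-congˡ (⁻¹-involutive g)) ⟨
    g ∙ (g ⁻¹ ∙ φ a ∙ g ⁻¹ ⁻¹) ≈⟨ ∙-congˡ (proj₂ (normal (g ⁻¹) a)) ⟩
    g ∙ φ (conj g a)           ∎

  φ∙∙φ : ∀ y a b → φ a ∙ y ∙ φ b ≈ y ∙ φ (conj y a ⊕ b)
  φ∙∙φ y a b = trans (∙-congʳ (φ∙≈∙φ-conj y a)) (∙φ∙φ y (conj y a) b)

  conj-additive : ∀ g → IsAdditive (conj g)
  conj-additive g = additive λ a b → ∙φ-injective g (begin
    g ∙ φ (conj g (a ⊕ b))         ≈⟨ φ∙≈∙φ-conj g (a ⊕ b) ⟨
    φ (a ⊕ b) ∙ g                  ≈⟨ ∙-congʳ (φ.∙-homo a b) ⟩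
    φ a ∙ φ b ∙ g                  ≈⟨ assoc (φ a) (φ b) g ⟩
    φ a ∙ (φ b ∙ g)                ≈⟨ ∙-congˡ (φ∙≈∙φ-conj g b) ⟩
    φ a ∙ (g ∙ φ (conj g b))       ≈⟨ assoc (φ a) g _ ⟨
    φ a ∙ g ∙ φ (conj g b)         ≈⟨ φ∙∙φ g a (conj g b) ⟩
    g ∙ φ (conj g a ⊕ conj g b)    ∎)

  ∙-coordinates : ∀ {x} t h s m → x ≈ t ∙ φ h → s ∙ φ m ∙ x ≈ s ∙ t ∙ φ (conj t m ⊕ h)
  ∙-coordinates {x} t h s m x≈t∙φh = begin
    s ∙ φ m ∙ x                  ≈⟨ ∙-congˡ x≈t∙φh ⟩
    s ∙ φ m ∙ (t ∙ φ h)          ≈⟨ assoc s (φ m) _ ⟩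
    s ∙ (φ m ∙ (t ∙ φ h))        ≈⟨ ∙-congˡ (assoc (φ m) t (φ h)) ⟨
    s ∙ (φ m ∙ t ∙ φ h)          ≈⟨ ∙-congˡ (φ∙∙φ t m h) ⟩
    s ∙ (t ∙ φ (conj t m ⊕ h))   ≈⟨ assoc s t _ ⟨
    s ∙ t ∙ φ (conj t m ⊕ h)     ∎

  ⁻¹∙-coordinates : ∀ {x} t h s m → x ≈ t ∙ φ h →
                    x ⁻¹ ∙ (s ∙ φ m) ≈ t ⁻¹ ∙ s ∙ φ (conj (t ⁻¹ ∙ s) (⊖ h) ⊕ m)
  ⁻¹∙-coordinates {x} t h s m x≈t∙φh = begin
    x ⁻¹ ∙ (s ∙ φ m)                          ≈⟨ ∙-congʳ (⁻¹-cong x≈t∙φh) ⟩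
    (t ∙ φ h) ⁻¹ ∙ (s ∙ φ m)                  ≈⟨ ∙-congʳ (⁻¹-anti-homo-∙ t (φ h)) ⟩
    φ h ⁻¹ ∙ t ⁻¹ ∙ (s ∙ φ m)                 ≈⟨ ∙-congʳ (∙-congʳ (φ.⁻¹-homo h)) ⟨
    φ (⊖ h) ∙ t ⁻¹ ∙ (s ∙ φ m)                ≈⟨ assoc _ (t ⁻¹) _ ⟩
    φ (⊖ h) ∙ (t ⁻¹ ∙ (s ∙ φ m))              ≈⟨ ∙-congˡ (assoc (t ⁻¹) s (φ m)) ⟨
    φ (⊖ h) ∙ (t ⁻¹ ∙ s ∙ φ m)                ≈⟨ assoc _ _ (φ m) ⟨
    φ (⊖ h) ∙ (t ⁻¹ ∙ s) ∙ φ m                ≈⟨ φ∙∙φ (t ⁻¹ ∙ s) (⊖ h) m ⟩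
    t ⁻¹ ∙ s ∙ φ (conj (t ⁻¹ ∙ s) (⊖ h) ⊕ m)  ∎

module Transversal {c ℓ} (G : Group c ℓ) (H : NormalC₃×C₃ G)
                   {n} (enumeration : Bijection (Group.setoid G) (≡.setoid (Fin n))) where

  open Group G renaming (refl to ≈-refl)
  open NormalC₃×C₃ H
  open Cosets G H
  open import Relation.Binary.Reasoning.Setoid setoid
  private module E = Bijection enumeration

  infix 4 _≈?_ _~?_

  _≈?_ : Decidable₂ _≈_
  x ≈? y = map′ E.injective E.cong (E.to x ≟F E.to y)

  _~?_ : Decidable₂ _~_
  x ~? y = ∃-V? λ a → x ≈? y ∙ φ a

  open CanonicalRepresentative ~-isEquivalence _~?_ E.to⁻
         (λ x → E.to x , ≈⇒~ (E.injective (proj₂ (E.surjective (E.to x)) ≈-refl)))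
    public renaming (canonical to rep; canonical-~ to rep-~; canonical-cong to rep-cong)

  offset : Carrier → V
  offset x = proj₁ (~-sym (rep-~ x))

  decomposition : ∀ x → x ≈ rep x ∙ φ (offset x)
  decomposition x = proj₂ (~-sym (rep-~ x))

  coordinates-unique : ∀ {x t h} → x ≈ rep t ∙ φ h → rep x ≡ rep t × offset x ≡ h
  coordinates-unique {x} {t} {h} x≈ = rep-x≡rep-t , ∙φ-injective (rep t) (begin
    rep t ∙ φ (offset x)  ≡⟨ cong (λ r → r ∙ φ (offset x)) rep-x≡rep-t ⟨
    rep x ∙ φ (offset x)  ≈⟨ decomposition x ⟨
    x                     ≈⟨ x≈ ⟩
    rep t ∙ φ h           ∎)
    where
    rep-x≡rep-t : rep x ≡ rep t
    rep-x≡rep-t = rep-cong (~-trans (h , x≈) (rep-~ t))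

  coordinates-cong : ∀ {x y} → x ≈ y → rep x ≡ rep y × offset x ≡ offset y
  coordinates-cong {y = y} x≈y = coordinates-unique (trans x≈y (decomposition y))

  glue : (Carrier → Carrier) → (Carrier → V → V) → Carrier → Carrier
  glue P L x = P (rep x) ∙ φ (L (rep x) (offset x))

  glue-cong : ∀ P L → Congruent _≈_ _≈_ (glue P L)
  glue-cong P L x≈y = reflexive (uncurry (cong₂ (λ t h → P t ∙ φ (L t h))) (coordinates-cong x≈y))

  glue-bijective : ∀ P L → IsBijectionOf (Quotient G H) P → (∀ t → Invertible (L t)) →
                   IsBijectionOf rawGroup (glue P L)
  glue-bijective P L (_ , P-injective , P-surjective) L-invertible =
    glue-cong P L , injective , surjective
    where
    injective : ∀ {x y} → glue P L x ≈ glue P L y → x ≈ y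
    injective {x} {y} e = begin
      x                     ≈⟨ decomposition x ⟩
      rep x ∙ φ (offset x)  ≡⟨ cong₂ (λ t h → t ∙ φ h) rep≡ offset≡ ⟩
      rep y ∙ φ (offset y)  ≈⟨ decomposition y ⟨
      y                     ∎
      where
      rep≡ : rep x ≡ rep y
      rep≡ = rep-cong (~-trans (~-sym (rep-~ x)) (~-trans (P-injective (∙φ≈∙φ⇒~ e)) (rep-~ y)))
      offset≡ : offset x ≡ offset y
      offset≡ = invertible⇒injective (L-invertible (rep y)) (∙φ-injective (P (rep y))
        (trans (reflexive (cong (λ t → P t ∙ φ (L t (offset x))) (≡.sym rep≡))) e))

    surjective : ∀ y → ∃ λ x → ∀ {z} → z ≈ x → glue P L z ≈ y
    surjective y = x , λ z≈x → trans (glue-cong P L z≈x) (begin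
      P (rep x) ∙ φ (L (rep x) (offset x))  ≡⟨ cong₂ (λ t h → P t ∙ φ (L t h)) rep≡ offset≡ ⟩
      P t ∙ φ (L t (L⁻¹ b))                 ≡⟨ cong (λ h → P t ∙ φ h) (L∘L⁻¹ b) ⟩
      P t ∙ φ b                             ≈⟨ y≈ ⟨
      y                                     ∎)
      where
      x₀ = proj₁ (P-surjective y)
      t = rep x₀
      Pt~y : P t ~ y
      Pt~y = proj₂ (P-surjective y) (rep-~ x₀)
      b = proj₁ (~-sym Pt~y)
      y≈ : y ≈ P t ∙ φ b
      y≈ = proj₂ (~-sym Pt~y)
      L⁻¹ = proj₁ (L-invertible t)
      L∘L⁻¹ = proj₁ (proj₂ (L-invertible t))
      x = t ∙ φ (L⁻¹ b)
      rep≡ : rep x ≡ t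
      rep≡ = proj₁ (coordinates-unique ≈-refl)
      offset≡ : offset x ≡ L⁻¹ b
      offset≡ = proj₂ (coordinates-unique ≈-refl)

module Lift {c ℓ} (G : Group c ℓ) (H : NormalC₃×C₃ G)
            {n} (enumeration : Bijection (Group.setoid G) (≡.setoid (Fin n)))
            (τ : Group.Carrier G → Group.Carrier G) where

  open Group G
  open NormalC₃×C₃ H
  open Cosets G H
  open Transversal G H enumeration public
  open import Relation.Binary.Reasoning.Setoid setoid

  conjMatrix : Carrier → Mat
  conjMatrix t = matrixOf (conj t)

  conj-linear : ∀ t → conj t ≗ ⟦ conjMatrix t ⟧
  conj-linear t = additive⇒linear (conj-additive t)

  private
    choice : ∀ t → ∃ (Fibres.Admissible (conjMatrix t) (conjMatrix (t ⁻¹ ∙ τ t)))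
    choice t = admissible-exists (conjMatrix t) (conjMatrix (t ⁻¹ ∙ τ t))

  module F (t : Carrier) = Fibres (conjMatrix t) (conjMatrix (t ⁻¹ ∙ τ t)) (proj₁ (choice t))

  admissible : ∀ t → F.Admissible t
  admissible t = proj₂ (choice t)

  σ : Carrier → Carrier
  σ = glue τ F.fibre₁

  σ-cong : Congruent _≈_ _≈_ σ
  σ-cong = glue-cong τ F.fibre₁

  σ∙id≈glue : ∀ x → σ x ∙ x ≈ glue (λ t → τ t ∙ t) F.fibre₂ x
  σ∙id≈glue x = begin
    σ x ∙ x                                        ≈⟨ ∙-coordinates t h (τ t) _ (decomposition x) ⟩
    τ t ∙ t ∙ φ (conj t (F.fibre₁ t h) ⊕ h)        ≡⟨ cong (λ v → τ t ∙ t ∙ φ (v ⊕ h)) (conj-linear t _) ⟩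
    glue (λ t → τ t ∙ t) F.fibre₂ x                ∎
    where t = rep x; h = offset x

  ⁻¹∙σ≈glue : ∀ x → x ⁻¹ ∙ σ x ≈ glue (λ t → t ⁻¹ ∙ τ t) F.fibre₃ x
  ⁻¹∙σ≈glue x = begin
    x ⁻¹ ∙ σ x                                     ≈⟨ ⁻¹∙-coordinates t h (τ t) _ (decomposition x) ⟩
    u ∙ φ (conj u (⊖ h) ⊕ F.fibre₁ t h)           ≡⟨ cong (λ v → u ∙ φ (v ⊕ F.fibre₁ t h)) (conj-linear u (⊖ h)) ⟩
    glue (λ t → t ⁻¹ ∙ τ t) F.fibre₃ x             ∎
    where t = rep x; h = offset x; u = t ⁻¹ ∙ τ t

  ⁻¹∙σ∙id≈glue : ∀ x → x ⁻¹ ∙ σ x ∙ x ≈ glue (λ t → t ⁻¹ ∙ τ t ∙ t) F.fibre₄ x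
  ⁻¹∙σ∙id≈glue x = begin
    x ⁻¹ ∙ σ x ∙ x                                 ≈⟨ ∙-congʳ (⁻¹∙σ≈glue x) ⟩
    u ∙ φ (F.fibre₃ t h) ∙ x                       ≈⟨ ∙-coordinates t h u _ (decomposition x) ⟩
    u ∙ t ∙ φ (conj t (F.fibre₃ t h) ⊕ h)          ≡⟨ cong (λ v → u ∙ t ∙ φ (v ⊕ h)) (conj-linear t _) ⟩
    glue (λ t → t ⁻¹ ∙ τ t ∙ t) F.fibre₄ x         ∎
    where t = rep x; h = offset x; u = t ⁻¹ ∙ τ t

  σ-bijective : IsBijectionOf (Quotient G H) τ → IsBijectionOf rawGroup σ
  σ-bijective τ-bij =
    glue-bijective τ F.fibre₁ τ-bij λ t → F.fibre₁-invertible t (admissible t)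

  σ∙id-bijective : IsBijectionOf (Quotient G H) (λ t → τ t ∙ t) →
                   IsBijectionOf rawGroup (λ x → σ x ∙ x)
  σ∙id-bijective τ∙id-bij = isBijection-resp G σ∙id≈glue (λ e → ∙-cong (σ-cong e) e)
    (glue-bijective (λ t → τ t ∙ t) F.fibre₂ τ∙id-bij λ t → F.fibre₂-invertible t (admissible t))

  ⁻¹∙σ-bijective : IsBijectionOf (Quotient G H) (λ t → t ⁻¹ ∙ τ t) →
                   IsBijectionOf rawGroup (λ x → x ⁻¹ ∙ σ x)
  ⁻¹∙σ-bijective ⁻¹∙τ-bij = isBijection-resp G ⁻¹∙σ≈glue (λ e → ∙-cong (⁻¹-cong e) (σ-cong e))
    (glue-bijective (λ t → t ⁻¹ ∙ τ t) F.fibre₃ ⁻¹∙τ-bij λ t → F.fibre₃-invertible t (admissible t))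

  ⁻¹∙σ∙id-bijective : IsBijectionOf (Quotient G H) (λ t → t ⁻¹ ∙ τ t ∙ t) →
                      IsBijectionOf rawGroup (λ x → x ⁻¹ ∙ σ x ∙ x)
  ⁻¹∙σ∙id-bijective ⁻¹∙τ∙id-bij =
    isBijection-resp G ⁻¹∙σ∙id≈glue (λ e → ∙-cong (∙-cong (⁻¹-cong e) (σ-cong e)) e)
      (glue-bijective (λ t → t ⁻¹ ∙ τ t ∙ t) F.fibre₄ ⁻¹∙τ∙id-bij λ t → F.fibre₄-invertible t (admissible t))

theorem3p3 : ∀ {c ℓ} (G : Group c ℓ) → IsFinite3Group G → (H : NormalC₃×C₃ G) →
             Colourable (Quotient G H) → ColourableGroup G
theorem3p3 G (_ , enumeration) H (τ , τ-bij , τ∙id-bij , ⁻¹∙τ-bij , ⁻¹∙τ∙id-bij) =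
    σ
  , σ-bijective τ-bij
  , σ∙id-bijective τ∙id-bij
  , ⁻¹∙σ-bijective ⁻¹∙τ-bij
  , ⁻¹∙σ∙id-bijective ⁻¹∙τ∙id-bij
  where open Lift G H enumeration τ
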